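{- Let $\mathcal{M}$ be a matroid, let $I$ be an independent set of $\mathcal{M}$, let $X=\{x_1,\ldots,x_k\}\subseteq I$ and $Y=\{y_1,\ldots,y_k\}\subseteq \operatorname{span}_{\mathcal{M}}(I)\setminus I$ be such that $(I\setminus X)\cup Y$ is independent and $\operatorname{span}_{\mathcal{M}}((I\setminus X)\cup Y)=\operatorname{span}_{\mathcal{M}}(I)$. Suppose $y_{k+1}\in \operatorname{span}_{\mathcal{M}}(I)\setminus I$ and $x_{k+1}$ satisfy $x_{k+1}\in C_{\mathcal{M}}(I,y_{k+1})\setminus X$ and $x_{k+1}\notin C_{\mathcal{M}}(I,y_i)$ for all $i=1,\ldots,k$. Then $x_{k+1}\in C_{\mathcal{M}}((I\setminus X)\cup Y,\,y_{k+1})$.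
   Context: $\operatorname{span}_{\mathcal{M}}(A)$ denotes the closure (span) of $A$ in $\mathcal{M}$. If $J$ is independent in $\mathcal{M}$ and $J\cup\{x\}$ is dependent, then there is a unique minimal subset of $J$ spanning $x$; it is denoted $C_{\mathcal{M}}(J,x)$ and called the $\mathcal{M}$-support of $x$ in $J$ (for $x\notin J$ it equals the unique circuit contained in $J\cup\{x\}$, minus $x$). -}

module Defs where

open import Level using (Level; suc; _⊔_)
open import Data.Nat using (ℕ; _<_)
open import Data.Fin using (Fin)
open import Data.Fin.Subset using (Subset; ⊥; _∈_; _∉_; _⊆_; _∪_; _─_; ⁅_⁆; ∣_∣)
open import Data.Product using (Σ; ∃; _×_)
open import Data.Sum using (_⊎_)
open import Relation.Nullary using (¬_)
open import Relation.Binary.PropositionalEquality using (_≡_)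

record Matroid (n : ℕ) : Set₁ where
  field
    Indep        : Subset n → Set
    indep-empty  : Indep ⊥
    indep-subset : ∀ {A B} → A ⊆ B → Indep B → Indep A
    indep-augment : ∀ {A B} → Indep A → Indep B → ∣ A ∣ < ∣ B ∣ →
                    ∃ λ x → x ∈ B × x ∉ A × Indep (A ∪ ⁅ x ⁆)

module _ {n : ℕ} (M : Matroid n) where
  open Matroid M

  -- x ∈ span_M(A): x ∈ A, or x closes a dependency with some independent subset of A
  -- (equivalently r(A ∪ {x}) = r(A)).
  InSpan : Subset n → Fin n → Set
  InSpan A x = x ∈ A ⊎ (∃ λ J → J ⊆ A × Indep J × ¬ Indep (J ∪ ⁅ x ⁆))

  IsSupport : Subset n → Fin n → Subset n → Set
  IsSupport J x C = C ⊆ J × InSpan C x × (∀ C′ → C′ ⊆ C → InSpan C′ x → C′ ≡ C)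

module Submission where

open import Defs
open import Data.Nat using (ℕ; _<_)
open import Data.Nat.Properties using (<-cmp; <-irrefl)
open import Data.Fin using (Fin)
open import Data.Fin.Subset using (Subset; _∈_; _∉_; _⊆_; _∪_; _∩_; _─_; _-_; ⁅_⁆; ∣_∣; inside; outside)
open import Data.Fin.Subset.Properties
  using ( _∈?_; x∈⁅x⁆; x∈⁅y⁆⇒x≡y; p⊆p∪q; q⊆p∪q; x∈p∪q⁺; x∈p∪q⁻; p∩q⊆p; p∩q⊆q; x∈p∩q⁺
        ; p─q⊆p; x∈p∧x≢y⇒x∈p-y; x∈p⇒p-x⊂p; p⊂q⇒∣p∣<∣q∣ )
open import Data.Fin.Properties using (any?)
open import Data.Vec using ([]; _∷_; there)
open import Data.List using (List; []; _∷_; allFin)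
open import Data.List.Relation.Unary.All using (All; []; _∷_)
import Data.List.Relation.Unary.All as All
open import Data.List.Membership.Propositional.Properties using (∈-allFin)
open import Data.Product using (∃; _×_; _,_)
open import Data.Sum using (_⊎_; inj₁; inj₂; [_,_]′)
open import Data.Empty using (⊥-elim)
open import Relation.Nullary using (¬_; Dec; yes; no)
open import Relation.Nullary.Decidable using (_×-dec_; ¬?; decidable-stable)
open import Relation.Binary.Definitions using (tri<; tri≈; tri>)
open import Relation.Binary.PropositionalEquality using (_≡_; refl; sym; trans; subst)
open import Function using (id; _∘_)
open import Function.Bundles using (_⇔_)

-- Put A = I - x′.  Every element of the support C of y′ in
-- (I ─ X) ∪ Y is spanned by A: elements of I ─ X lie in A once x′ ∉ C, and
-- each y ∈ Y has its I-support inside A.  By transitivity of the span, A spans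
-- y′.  The I-support D of y′ also spans y′, and two subsets of an independent
-- set I which both span y′ ∉ I have an intersection that spans y′ as well.
-- So A ∩ D ⊆ D spans y′, minimality of D gives A ∩ D = D, and x′ ∈ D lands in
-- A = I - x′, which is absurd.  Hence x′ ∈ C.
--
-- The matroid facts are proved with bases: maximal independent subsets of a
-- set S all have the same size (by augmentation), and every independent
-- subset of S extends to one.  The extension needs independence to be
-- decidable; since the theorem's conclusion x′ ∈ C is decidable, we may
-- assume this classically, via the double negation of decidability.

∪-monoˡ : ∀ {n} {p q : Subset n} (r : Subset n) → p ⊆ q → p ∪ r ⊆ q ∪ r
∪-monoˡ {p = p} r p⊆q x∈p∪r with x∈p∪q⁻ p r x∈p∪r
... | inj₁ x∈p = x∈p∪q⁺ (inj₁ (p⊆q x∈p))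
... | inj₂ x∈r = x∈p∪q⁺ (inj₂ x∈r)

∪⁅⁆-⊆ : ∀ {n} {p s : Subset n} {x : Fin n} → p ⊆ s → x ∈ s → p ∪ ⁅ x ⁆ ⊆ s
∪⁅⁆-⊆ {p = p} {x = x} p⊆s x∈s y∈ with x∈p∪q⁻ p ⁅ x ⁆ y∈
... | inj₁ y∈p = p⊆s y∈p
... | inj₂ y∈x = subst (_∈ _) (sym (x∈⁅y⁆⇒x≡y x y∈x)) x∈s

⊆-avoiding : ∀ {n} {p q : Subset n} {x : Fin n} → p ⊆ q → x ∉ p → p ⊆ q - x
⊆-avoiding p⊆q x∉p y∈p = x∈p∧x≢y⇒x∈p-y (p⊆q y∈p) (λ { refl → x∉p y∈p })

x∉p-x : ∀ {n} (p : Subset n) (x : Fin n) → x ∉ p - x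
x∉p-x (inside ∷ p) Fin.zero ()
x∉p-x (s ∷ p) (Fin.suc x) (there x∈) = x∉p-x p x x∈

¬¬-decidable : ∀ {n} (P : Subset n → Set) → ¬ ¬ (∀ A → Dec (P A))
¬¬-decidable {ℕ.zero} P k = k (λ { [] → no (λ p → k (λ { [] → yes p })) })
¬¬-decidable {ℕ.suc n} P k =
  ¬¬-decidable (λ A → P (inside ∷ A)) λ decIn →
  ¬¬-decidable (λ A → P (outside ∷ A)) λ decOut →
  k (λ { (inside ∷ A) → decIn A ; (outside ∷ A) → decOut A })

module MatroidTheory {n : ℕ} (M : Matroid n) where
  open Matroid M

  -- For independent A, x ∈ span(A) means: x ∈ A or A + x is dependent.
  Spanned : Subset n → Fin n → Set
  Spanned A x = x ∈ A ⊎ ¬ Indep (A ∪ ⁅ x ⁆)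

  dependent-mono : ∀ {A B y} → A ⊆ B → ¬ Indep (A ∪ ⁅ y ⁆) → ¬ Indep (B ∪ ⁅ y ⁆)
  dependent-mono {y = y} A⊆B depA indB = depA (indep-subset (∪-monoˡ ⁅ y ⁆ A⊆B) indB)

  span-mono : ∀ {P Q x} → P ⊆ Q → InSpan M P x → InSpan M Q x
  span-mono P⊆Q (inj₁ x∈P) = inj₁ (P⊆Q x∈P)
  span-mono P⊆Q (inj₂ (J , J⊆P , indJ , depJ)) = inj₂ (J , P⊆Q ∘ J⊆P , indJ , depJ)

  inSpan⇒spanned : ∀ {A x} → InSpan M A x → Spanned A x
  inSpan⇒spanned (inj₁ x∈A) = inj₁ x∈A
  inSpan⇒spanned (inj₂ (J , J⊆A , _ , depJ)) = inj₂ (dependent-mono J⊆A depJ)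

  Unextendable : Subset n → Subset n → Fin n → Set
  Unextendable S B z = z ∈ S → z ∉ B → ¬ Indep (B ∪ ⁅ z ⁆)

  Basis : Subset n → Subset n → Set
  Basis S B = B ⊆ S × Indep B × (∀ z → Unextendable S B z)

  -- All bases of S have the same size: otherwise the smaller one could be
  -- augmented from the larger one inside S.
  basis-card : ∀ {S B₁ B₂} → Basis S B₁ → Basis S B₂ → ∣ B₁ ∣ ≡ ∣ B₂ ∣
  basis-card {B₁ = B₁} {B₂} (S⊇B₁ , ind₁ , max₁) (S⊇B₂ , ind₂ , max₂)
    with <-cmp ∣ B₁ ∣ ∣ B₂ ∣
  ... | tri≈ _ eq _ = eq
  ... | tri< lt _ _ =
    let (x , x∈B₂ , x∉B₁ , indB₁x) = indep-augment ind₁ ind₂ lt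
    in ⊥-elim (max₁ x (S⊇B₂ x∈B₂) x∉B₁ indB₁x)
  ... | tri> _ _ gt =
    let (x , x∈B₁ , x∉B₂ , indB₂x) = indep-augment ind₂ ind₁ gt
    in ⊥-elim (max₂ x (S⊇B₁ x∈B₁) x∉B₂ indB₂x)

  basis-restrict : ∀ {S S₁ B} → S₁ ⊆ S → B ⊆ S₁ → Basis S B → Basis S₁ B
  basis-restrict S₁⊆S B⊆S₁ (_ , indB , maxB) = B⊆S₁ , indB , λ z → maxB z ∘ S₁⊆S

  basis-of-spanning : ∀ {A C} → Indep A → (∀ z → z ∈ C → Spanned A z) → Basis (A ∪ C) A
  basis-of-spanning {A} {C} indA spans = p⊆p∪q C , indA , unext
    where
    unext : ∀ z → Unextendable (A ∪ C) A z
    unext z z∈A∪C z∉A with x∈p∪q⁻ A C z∈A∪C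
    ... | inj₁ z∈A = ⊥-elim (z∉A z∈A)
    ... | inj₂ z∈C with spans z z∈C
    ...   | inj₁ z∈A = ⊥-elim (z∉A z∈A)
    ...   | inj₂ depAz = depAz

  basis-of-spanned : ∀ {A P y} → Indep P → A ⊆ P → ¬ Indep (A ∪ ⁅ y ⁆) → Basis (P ∪ ⁅ y ⁆) P
  basis-of-spanned {A} {P} {y} indP A⊆P depAy = basis-of-spanning indP spansY
    where
    spansY : ∀ z → z ∈ ⁅ y ⁆ → Spanned P z
    spansY z z∈y rewrite x∈⁅y⁆⇒x≡y y z∈y = inj₂ (dependent-mono A⊆P depAy)

  module WithDecidableIndependence (indep? : ∀ A → Dec (Indep A)) where

    greedy : (L : List (Fin n)) {S B : Subset n} → B ⊆ S → Indep B →
             ∃ λ B′ → B ⊆ B′ × B′ ⊆ S × Indep B′ × All (Unextendable S B′) L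
    greedy [] B⊆S indB = _ , id , B⊆S , indB , []
    greedy (z ∷ L) {S} {B} B⊆S indB with (z ∈? S) ×-dec indep? (B ∪ ⁅ z ⁆)
    ... | yes (z∈S , indBz) =
      let (B′ , Bz⊆B′ , B′⊆S , indB′ , unext) = greedy L (∪⁅⁆-⊆ B⊆S z∈S) indBz
          z∈B′ = Bz⊆B′ (q⊆p∪q B ⁅ z ⁆ (x∈⁅x⁆ z))
      in B′ , Bz⊆B′ ∘ p⊆p∪q ⁅ z ⁆ , B′⊆S , indB′ , (λ _ z∉B′ → ⊥-elim (z∉B′ z∈B′)) ∷ unext
    ... | no ¬addable =
      let (B′ , B⊆B′ , B′⊆S , indB′ , unext) = greedy L B⊆S indB
      in B′ , B⊆B′ , B′⊆S , indB′ ,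
         (λ z∈S _ → dependent-mono B⊆B′ (λ indBz → ¬addable (z∈S , indBz))) ∷ unext

    extend : (S K : Subset n) → K ⊆ S → Indep K → ∃ λ B → K ⊆ B × Basis S B
    extend S K K⊆S indK =
      let (B , K⊆B , B⊆S , indB , unext) = greedy (allFin n) K⊆S indK
      in B , K⊆B , B⊆S , indB , λ z → All.lookup unext (∈-allFin z)

    -- A basis B of A ∪ C through the
    -- independent J ⊆ C spanning y has size ∣ A ∣; augmenting B from an
    -- independent A + y either extends B inside A ∪ C or makes J + y independent.
    span-trans : ∀ {A C y} → Indep A → (∀ z → z ∈ C → Spanned A z) →
                 InSpan M C y → y ∉ A → ¬ Indep (A ∪ ⁅ y ⁆)
    span-trans indA spans (inj₁ y∈C) y∉A with spans _ y∈C
    ... | inj₁ y∈A = ⊥-elim (y∉A y∈A)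
    ... | inj₂ depAy = depAy
    span-trans {A} {C} {y} indA spans (inj₂ (J , J⊆C , indJ , depJy)) y∉A indAy
      with extend (A ∪ C) J (q⊆p∪q A C ∘ J⊆C) indJ
    ... | B , J⊆B , basisB@(_ , indB , maxB)
      with indep-augment indB indAy smaller
      where
      smaller : ∣ B ∣ < ∣ A ∪ ⁅ y ⁆ ∣
      smaller = subst (_< ∣ A ∪ ⁅ y ⁆ ∣)
                  (sym (basis-card basisB (basis-of-spanning indA spans)))
                  (p⊂q⇒∣p∣<∣q∣ (p⊆p∪q ⁅ y ⁆ , y , q⊆p∪q A ⁅ y ⁆ (x∈⁅x⁆ y) , y∉A))
    ... | x , x∈Ay , x∉B , indBx with x∈p∪q⁻ A ⁅ y ⁆ x∈Ay
    ...   | inj₁ x∈A = maxB x (p⊆p∪q C x∈A) x∉B indBx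
    ...   | inj₂ x∈y rewrite x∈⁅y⁆⇒x≡y y x∈y = dependent-mono J⊆B depJy indBx

    -- Otherwise extend (A ∩ D) + y to a basis B of
    -- P + y, P = A ∪ D.  As D + y is dependent, some z ∈ D is missing from B,
    -- and z ∉ A.  Then B and P are bases of P + y, while B and P - z are bases
    -- of (P - z) + y, so ∣ P ∣ = ∣ B ∣ = ∣ P - z ∣, which is impossible.
    span-meet : ∀ {I A D y} → Indep I → A ⊆ I → D ⊆ I → y ∉ I →
                ¬ Indep (A ∪ ⁅ y ⁆) → ¬ Indep (D ∪ ⁅ y ⁆) → ¬ Indep ((A ∩ D) ∪ ⁅ y ⁆)
    span-meet {I} {A} {D} {y} indI A⊆I D⊆I y∉I depAy depDy indK
      with extend ((A ∪ D) ∪ ⁅ y ⁆) ((A ∩ D) ∪ ⁅ y ⁆)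
             (∪-monoˡ ⁅ y ⁆ (p⊆p∪q D ∘ p∩q⊆p A D)) indK
    ... | B , K⊆B , basisB@(B⊆S , indB , _)
      with any? (λ z → (z ∈? D) ×-dec ¬? (z ∈? B))
    ... | no D⊆B = depDy (indep-subset Dy⊆B indB)
      where
      Dy⊆B : D ∪ ⁅ y ⁆ ⊆ B
      Dy⊆B {w} w∈ with x∈p∪q⁻ D ⁅ y ⁆ w∈ | w ∈? B
      ... | _ | yes w∈B = w∈B
      ... | inj₁ w∈D | no w∉B = ⊥-elim (D⊆B (w , w∈D , w∉B))
      ... | inj₂ w∈y | no w∉B = ⊥-elim (w∉B (K⊆B (q⊆p∪q _ ⁅ y ⁆ w∈y)))
    ... | yes (z , z∈D , z∉B) = <-irrefl (trans (sym sizeB-P-z) sizeB-P) shrinks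
      where
      P = A ∪ D
      indP : Indep P
      indP = indep-subset (λ w∈P → [ A⊆I , D⊆I ]′ (x∈p∪q⁻ A D w∈P)) indI
      z∉A : z ∉ A
      z∉A z∈A = z∉B (K⊆B (p⊆p∪q ⁅ y ⁆ (x∈p∩q⁺ (z∈A , z∈D))))
      sizeB-P : ∣ B ∣ ≡ ∣ P ∣
      sizeB-P = basis-card basisB (basis-of-spanned indP (p⊆p∪q D) depAy)
      B⊆P-z+y : B ⊆ (P - z) ∪ ⁅ y ⁆
      B⊆P-z+y {w} w∈B with x∈p∪q⁻ P ⁅ y ⁆ (B⊆S w∈B)
      ... | inj₁ w∈P = x∈p∪q⁺ (inj₁ (x∈p∧x≢y⇒x∈p-y w∈P (λ { refl → z∉B w∈B })))
      ... | inj₂ w∈y = x∈p∪q⁺ (inj₂ w∈y)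
      sizeB-P-z : ∣ B ∣ ≡ ∣ P - z ∣
      sizeB-P-z = basis-card
        (basis-restrict (∪-monoˡ ⁅ y ⁆ (p─q⊆p P ⁅ z ⁆)) B⊆P-z+y basisB)
        (basis-of-spanned (indep-subset (p─q⊆p P ⁅ z ⁆) indP)
                          (⊆-avoiding (p⊆p∪q D) z∉A) depAy)
      shrinks : ∣ P - z ∣ < ∣ P ∣
      shrinks = p⊂q⇒∣p∣<∣q∣ (x∈p⇒p-x⊂p (q⊆p∪q A D z∈D))

    support-contains : ∀ (I X Y : Subset n) (x′ y′ : Fin n) → Indep I → y′ ∉ I →
      (∃ λ D → IsSupport M I y′ D × x′ ∈ D) →
      (∀ y → y ∈ Y → ∃ λ C → IsSupport M I y C × x′ ∉ C) →
      ∀ C → IsSupport M ((I ─ X) ∪ Y) y′ C → ¬ x′ ∉ C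
    support-contains I X Y x′ y′ indI y′∉I (D , (D⊆I , D-spans , D-minimal) , x′∈D)
                     avoidY C (C⊆I─X∪Y , C-spans , _) x′∉C =
      x∉p-x I x′ (p∩q⊆p A D x′∈A∩D)
      where
      A = I - x′
      A⊆I : A ⊆ I
      A⊆I = p─q⊆p I ⁅ x′ ⁆
      C-spanned : ∀ z → z ∈ C → Spanned A z
      C-spanned z z∈C with x∈p∪q⁻ (I ─ X) Y (C⊆I─X∪Y z∈C)
      ... | inj₁ z∈I─X = inj₁ (x∈p∧x≢y⇒x∈p-y (p─q⊆p I X z∈I─X) (λ { refl → x′∉C z∈C }))
      ... | inj₂ z∈Y with avoidY z z∈Y
      ...   | Cz , (Cz⊆I , Cz-spans , _) , x′∉Cz =
                inSpan⇒spanned (span-mono (⊆-avoiding Cz⊆I x′∉Cz) Cz-spans)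
      depAy′ : ¬ Indep (A ∪ ⁅ y′ ⁆)
      depAy′ = span-trans (indep-subset A⊆I indI) C-spanned C-spans (y′∉I ∘ A⊆I)
      depDy′ : ¬ Indep (D ∪ ⁅ y′ ⁆)
      depDy′ with inSpan⇒spanned D-spans
      ... | inj₁ y′∈D = ⊥-elim (y′∉I (D⊆I y′∈D))
      ... | inj₂ depDy = depDy
      A∩D-spans : InSpan M (A ∩ D) y′
      A∩D-spans = inj₂ (A ∩ D , id , indep-subset (D⊆I ∘ p∩q⊆q A D) indI ,
                        span-meet indI A⊆I D⊆I y′∉I depAy′ depDy′)
      -- Minimality of the support D forces A ∩ D = D.
      x′∈A∩D : x′ ∈ A ∩ D
      x′∈A∩D = subst (x′ ∈_) (sym (D-minimal (A ∩ D) (p∩q⊆q A D) A∩D-spans)) x′∈D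

-- Lemma 3.5.  Membership in C is
-- decidable, so it suffices to refute x′ ∉ C, and within a refutation we may
-- assume independence decidable.
lemma3p5 : ∀ {n : ℕ} (M : Matroid n) (I X Y : Subset n) (x′ y′ : Fin n) →
    Matroid.Indep M I →
    X ⊆ I →
    ∣ X ∣ ≡ ∣ Y ∣ →
    (∀ y → y ∈ Y → InSpan M I y × y ∉ I) →
    Matroid.Indep M ((I ─ X) ∪ Y) →
    (∀ z → InSpan M ((I ─ X) ∪ Y) z ⇔ InSpan M I z) →
    InSpan M I y′ → y′ ∉ I →
    (∃ λ C → IsSupport M I y′ C × x′ ∈ C) →
    x′ ∉ X →
    (∀ y → y ∈ Y → ∃ λ C → IsSupport M I y C × x′ ∉ C) →
    ∀ C → IsSupport M ((I ─ X) ∪ Y) y′ C → x′ ∈ C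
lemma3p5 M I X Y x′ y′ indI _ _ _ _ _ _ y′∉I supportY′ _ avoidY C supportC =
  decidable-stable (x′ ∈? C) λ x′∉C →
    ¬¬-decidable (Matroid.Indep M) λ indep? →
      WithDecidableIndependence.support-contains indep?
        I X Y x′ y′ indI y′∉I supportY′ avoidY C supportC x′∉C
  where open MatroidTheory M
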